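{- Let $F = \langle f_\alpha : \alpha < \mathrm{non}(\mathcal{M})\rangle \subset \omega^\omega$ be a family such that for every infinite partial function $g$ from $\omega$ to $\omega$ there is $\alpha < \mathrm{non}(\mathcal{M})$ with $|g \cap f_\alpha| = \omega$. Let $\mathcal{A} \subset \omega^\omega$ be an a.d. family such that $F \subset \mathrm{tr}(\mathcal{A})$. Then $\mathcal{A}$ is Van Douwen MAD.
   Context: $\mathrm{non}(\mathcal{M})$ is the least size of a non-meager set of reals. Functions are identified with their graphs (subsets of $\omega\times\omega$); a partial function is infinite if its domain is infinite. An a.d. family $\mathcal{A}\subset\omega^\omega$ is one with $|f\cap g|<\omega$ for distinct $f,g\in\mathcal{A}$. For $f\in\omega^\omega$, a MAD family on $f$ is an a.d. family of infinite subsets of $f$ such that every infinite subset of $f$ meets some member in an infinite set (the family may be finite). $\mathcal{A}\cap f = \{f\cap h : h\in\mathcal{A},\ |f\cap h|=\omega\}$ and $\mathrm{tr}(\mathcal{A}) = \{f\in\omega^\omega : \mathcal{A}\cap f \text{ is a MAD family on } f\}$. An a.d. family $\mathcal{A}\subset\omega^\omega$ is Van Douwen MAD if for every infinite partial function $g$ from $\omega$ to $\omega$ there is $h\in\mathcal{A}$ with $|g\cap h|=\omega$. -}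

module Defs where

open import Data.Nat using (ℕ; _≤_)
open import Data.List using (List; length; lookup; _++_)
open import Data.Fin using (Fin; toℕ)
open import Data.Product using (Σ; ∃; _×_; _,_)
open import Data.Empty using (⊥)
open import Relation.Nullary using (¬_)
open import Relation.Binary.PropositionalEquality using (_≡_)
open import Function.Bundles using (_⇔_; _↣_)

Baire : Set
Baire = ℕ → ℕ

Infinite : (ℕ → Set) → Set
Infinite P = ∀ N → Σ ℕ λ n → N ≤ n × P n

Finite : (ℕ → Set) → Set
Finite P = Σ ℕ λ N → ∀ n → N ≤ n → ¬ P n

-- f ∩ h (graphs), viewed as a subset of ω via the domain
Agree : Baire → Baire → ℕ → Set
Agree f h n = f n ≡ h n

SameFun : Baire → Baire → Set
SameFun f h = ∀ n → f n ≡ h n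

SameSet : (ℕ → Set) → (ℕ → Set) → Set
SameSet X Y = ∀ n → X n ⇔ Y n

AlmostDisjoint : (Baire → Set) → Set
AlmostDisjoint 𝒜 = ∀ f h → 𝒜 f → 𝒜 h → ¬ SameFun f h → Finite (Agree f h)

-- Subsets of (the graph of) f are identified with subsets X of ω
-- (X ↦ f ↾ X).  A MAD family on f:
MADon : Baire → ((ℕ → Set) → Set) → Set₁
MADon f 𝒳 =
  (∀ X → 𝒳 X → Infinite X)
  × (∀ X Y → 𝒳 X → 𝒳 Y → ¬ SameSet X Y → Finite (λ n → X n × Y n))
  × (∀ Y → Infinite Y → Σ (ℕ → Set) λ X → 𝒳 X × Infinite (λ n → X n × Y n))

Trace : (Baire → Set) → Baire → (ℕ → Set) → Set
Trace 𝒜 f X = Σ Baire λ h → 𝒜 h × Infinite (Agree f h) × SameSet X (Agree f h)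

tr : (Baire → Set) → Baire → Set₁
tr 𝒜 f = MADon f (Trace 𝒜 f)

record PartialFn : Set₁ where
  field
    graph : ℕ → ℕ → Set
    functional : ∀ n a b → graph n a → graph n b → a ≡ b

dom : PartialFn → ℕ → Set
dom g n = Σ ℕ λ m → PartialFn.graph g n m

InfinitePartial : PartialFn → Set
InfinitePartial g = Infinite (dom g)

meetP : PartialFn → Baire → ℕ → Set
meetP g h n = PartialFn.graph g n (h n)

VanDouwenMAD : (Baire → Set) → Set₁
VanDouwenMAD 𝒜 =
  AlmostDisjoint 𝒜
  × (∀ (g : PartialFn) → InfinitePartial g → Σ Baire λ h → 𝒜 h × Infinite (meetP g h))

Extends : Baire → List ℕ → Set
Extends x s = ∀ (i : Fin (length s)) → x (toℕ i) ≡ lookup s i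

NowhereDense : (Baire → Set) → Set
NowhereDense N = ∀ (s : List ℕ) → Σ (List ℕ) λ t → ∀ x → Extends x (s ++ t) → ¬ N x

Meager : (Baire → Set) → Set₁
Meager S = Σ (ℕ → Baire → Set) λ Ns → (∀ k → NowhereDense (Ns k)) × (∀ x → S x → Σ ℕ λ k → Ns k x)

Range : {I : Set} → (I → Baire) → Baire → Set
Range {I} x z = Σ I λ i → SameFun (x i) z

-- I has cardinality non(M): some I-indexed set of reals is non-meager,
-- and every set of reals indexed by a set of strictly smaller cardinality is meager.
HasCardNonM : Set → Set₁
HasCardNonM I =
  (Σ (I → Baire) λ x → ¬ Meager (Range x))
  × (∀ (J : Set) → J ↣ I → ¬ (I ↣ J) → ∀ (y : J → Baire) → Meager (Range y))

-- Given an infinite partial g, some f = F α meets g on an infinite set Y.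
-- Since 𝒜 ∩ f is MAD on f, some trace f ∩ h (h ∈ 𝒜) meets Y infinitely,
-- and on that set g n = f n = h n.  The non(M) bound on the index set is
-- not needed for this step.
module Submission where

open import Defs
open import Data.Nat using (ℕ)
open import Data.Product using (Σ; _×_; _,_)
open import Function.Bundles using (Equivalence)
open import Relation.Binary.PropositionalEquality using (subst)

Infinite-mono : {P Q : ℕ → Set} → (∀ n → P n → Q n) → Infinite P → Infinite Q
Infinite-mono P⊆Q infP N with infP N
... | n , N≤n , Pn = n , N≤n , P⊆Q n Pn

meetP-transport : (g : PartialFn) (f h : Baire) (n : ℕ)
  → meetP g f n → Agree f h n → meetP g h n
meetP-transport g f h n gfn fn≡hn = subst (PartialFn.graph g n) fn≡hn gfn

tr-meets : (𝒜 : Baire → Set) {f : Baire} → tr 𝒜 f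
  → (g : PartialFn) → Infinite (meetP g f) → Σ Baire λ h → 𝒜 h × Infinite (meetP g h)
tr-meets 𝒜 {f} (_ , _ , maximal) g inf-gf
  with maximal (meetP g f) inf-gf
... | X , (h , h∈𝒜 , _ , X≈f∩h) , inf-X∩gf =
  h , h∈𝒜 , Infinite-mono on-X inf-X∩gf
  where
  on-X : ∀ n → X n × meetP g f n → meetP g h n
  on-X n (Xn , gfn) = meetP-transport g f h n gfn (Equivalence.to (X≈f∩h n) Xn)

lemma5 : (I : Set) → HasCardNonM I → (F : I → Baire)
    → (∀ (g : PartialFn) → InfinitePartial g → Σ I λ α → Infinite (meetP g (F α)))
    → (𝒜 : Baire → Set) → AlmostDisjoint 𝒜
    → (∀ α → tr 𝒜 (F α))
    → VanDouwenMAD 𝒜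
lemma5 I _ F F-covers 𝒜 ad F⊆tr = ad , meets
  where
  meets : ∀ (g : PartialFn) → InfinitePartial g → Σ Baire λ h → 𝒜 h × Infinite (meetP g h)
  meets g inf-g with F-covers g inf-g
  ... | α , inf-gFα = tr-meets 𝒜 (F⊆tr α) g inf-gFα
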